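{- Let $a$ and $m$ be positive integers and let $f_0(n)=\binom{a}{n-1}$ for $n=1,2,\ldots$. For $n\ge 1$, $f_m(n)$ equals the number of words of length $n-1$ over the alphabet $\{0,1,\ldots,a+m-1\}$ satisfying property $\mathcal P_1$.
   Context: For an arithmetic function $f_0$ defined on the positive integers, define recursively for $m\ge 1$: $c_m(n,k)=\sum_{i_1+\cdots+i_k=n} f_{m-1}(i_1)\cdots f_{m-1}(i_k)$, the sum over all $k$-tuples of positive integers $(i_1,\ldots,i_k)$ with sum $n$, and $f_m(n)=\sum_{k=1}^n c_m(n,k)$ (so $f_m$ is the $m$-th invert transform of $f_0$). A word over $\{0,1,\ldots,a+m-1\}$ satisfies property $\mathcal P_1$ if every maximal factor (block of consecutive letters) consisting only of letters from $\{0,1,\ldots,a-1\}$ has its letters in strictly ascending order. -}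

module Defs where

open import Data.Nat using (ℕ; zero; suc; _+_; _*_; _∸_; _<_; _≤_; _<?_; _≟_)
open import Data.Nat.Combinatorics using (_C_)
open import Data.Nat.ListAction using (sum; product)
open import Data.Fin using (Fin; toℕ)
open import Data.List using (List; []; _∷_; map; concatMap; filter; length; upTo; allFin)
open import Data.List.Relation.Unary.All using (All; all?)
open import Data.List.Relation.Unary.Linked using (Linked; linked?)
open import Relation.Nullary using (Dec; yes; no)
open import Relation.Binary.PropositionalEquality using (_≡_)

-- Arithmetic functions on the positive integers are modelled as ℕ → ℕ;
-- the value at 0 is never used.

tuples : (k n : ℕ) → List (List ℕ)
tuples zero    n = [] ∷ []
tuples (suc k) n = concatMap (λ i → map (i ∷_) (tuples k n)) (map suc (upTo n))

-- All k-tuples of positive integers (i₁,…,iₖ) with i₁ + ⋯ + iₖ = n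
-- (every entry of such a tuple is ≤ n, so filtering `tuples k n` is exhaustive).
compositions : (n k : ℕ) → List (List ℕ)
compositions n k = filter (λ t → sum t ≟ n) (tuples k n)

c : (ℕ → ℕ) → ℕ → ℕ → ℕ
c f n k = sum (map (λ t → product (map f t)) (compositions n k))

invert : (ℕ → ℕ) → ℕ → ℕ
invert f n = sum (map (λ k → c f n k) (map suc (upTo n)))

iterInvert : ℕ → (ℕ → ℕ) → ℕ → ℕ
iterInvert zero    f = f
iterInvert (suc m) f = invert (iterInvert m f)

f₀ : ℕ → ℕ → ℕ
f₀ a n = a C (n ∸ 1)

words : (N L : ℕ) → List (List (Fin N))
words N zero    = [] ∷ []
words N (suc L) = concatMap (λ x → map (x ∷_) (words N L)) (allFin N)

-- Maximal factors of a word consisting only of letters from {0,…,a-1}: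
-- the word is cut at every letter ≥ a (possibly empty factors arise between
-- adjacent large letters or at the ends; they are trivially ascending).
smallBlocks : ∀ {N} → ℕ → List (Fin N) → List (List ℕ)
smallBlocks a [] = [] ∷ []
smallBlocks a (x ∷ w) with toℕ x <? a | smallBlocks a w
... | yes _ | []       = (toℕ x ∷ []) ∷ []
... | yes _ | (b ∷ bs) = (toℕ x ∷ b) ∷ bs
... | no  _ | bs       = [] ∷ bs

P₁ : ∀ {N} → ℕ → List (Fin N) → Set
P₁ a w = All (Linked _<_) (smallBlocks a w)

P₁? : ∀ {N} (a : ℕ) (w : List (Fin N)) → Dec (P₁ a w)
P₁? a w = all? (linked? _<?_) (smallBlocks a w)

countP₁ : (a m L : ℕ) → ℕ
countP₁ a m L = length (filter (P₁? a) (words (a + m) L))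

module Submission where

-- With F_m(x) = Σₙ f_m(n+1) xⁿ and E(x) = (1+x)^a, the invert transform is G ↦ G/(1 − xG), so by
-- induction F_m = E/(1 − m·x·E), i.e. F_m = E + m·x·E·F_m. A word with property P₁ is an ascending
-- run of small letters (a subset of {0,…,a−1}, counted by a binomial coefficient), followed either
-- by nothing or by one of the m large letters and another such word; so the word counts satisfy
-- the same recurrence, which determines its solution uniquely.

open import Defs

open import Algebra.Properties.CommutativeSemigroup using (interchange)
open import Data.Bool using (Bool; true; false; if_then_else_; T)
open import Data.Empty using (⊥-elim)
open import Data.Fin using (Fin; toℕ)
import Data.Fin as Fin
open import Data.List using (List; []; _∷_; _++_; map; concatMap; filter; length; applyUpTo; upTo; allFin; tabulate)
open import Data.List.Properties using (map-∘; map-cong; map-++; map-tabulate)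
open import Data.List.Relation.Unary.All using (All; []; _∷_)
open import Data.List.Relation.Unary.Linked using (Linked; []; [-]; _∷_)
open import Data.Nat using (ℕ; zero; suc; _+_; _*_; _∸_; _<_; _≤_; z≤n; s≤s; s≤s⁻¹; z<s; s<s; _<?_; _≤?_; _≟_)
open import Data.Nat.Combinatorics using (_C_; nCk+nC[k+1]≡[n+1]C[k+1])
open import Data.Nat.Induction using (<-rec)
open import Data.Nat.ListAction using (sum; product)
open import Data.Nat.ListAction.Properties using (sum-++)
open import Data.Nat.Properties
open import Data.Nat.Tactic.RingSolver using (solve-∀)
open import Data.Product using (_×_; _,_; proj₁)
open import Data.Sum using (inj₁; inj₂)
open import Data.Unit using (⊤; tt)
open import Function using (_∘_; _⇔_; mk⇔; Equivalence)
open import Function.Properties.Equivalence using () renaming (trans to ⇔-trans; sym to ⇔-sym)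
open import Relation.Binary.PropositionalEquality
open import Relation.Nullary using (Dec; yes; no; does; ¬_)
open import Relation.Nullary.Decidable using (does-⇔; T?)
open import Relation.Unary using (Pred; Decidable)

-- Finite sums

∑< : ℕ → (ℕ → ℕ) → ℕ
∑< zero    f = 0
∑< (suc n) f = f 0 + ∑< n (f ∘ suc)

syntax ∑< n (λ i → e) = ∑[ i < n ] e

∑-cong : ∀ n {f g : ℕ → ℕ} → (∀ i → i < n → f i ≡ g i) → ∑< n f ≡ ∑< n g
∑-cong zero    f≡g = refl
∑-cong (suc n) f≡g = cong₂ _+_ (f≡g 0 z<s) (∑-cong n (λ i i<n → f≡g (suc i) (s<s i<n)))

∑-zero : ∀ n {f : ℕ → ℕ} → (∀ i → i < n → f i ≡ 0) → ∑< n f ≡ 0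
∑-zero zero    f≡0 = refl
∑-zero (suc n) f≡0 = cong₂ _+_ (f≡0 0 z<s) (∑-zero n (λ i i<n → f≡0 (suc i) (s<s i<n)))

∑-const : ∀ n k → ∑[ i < n ] k ≡ n * k
∑-const zero    k = refl
∑-const (suc n) k = cong (k +_) (∑-const n k)

∑-+ : ∀ n (f g : ℕ → ℕ) → ∑[ i < n ] (f i + g i) ≡ ∑< n f + ∑< n g
∑-+ zero    f g = refl
∑-+ (suc n) f g = trans (cong (f 0 + g 0 +_) (∑-+ n (f ∘ suc) (g ∘ suc)))
                       (interchange +-commutativeSemigroup (f 0) (g 0) _ _)

∑-distribˡ : ∀ n k (f : ℕ → ℕ) → ∑[ i < n ] (k * f i) ≡ k * ∑< n f
∑-distribˡ zero    k f = sym (*-zeroʳ k)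
∑-distribˡ (suc n) k f = trans (cong (k * f 0 +_) (∑-distribˡ n k (f ∘ suc)))
                               (sym (*-distribˡ-+ k (f 0) _))

∑-distribʳ : ∀ n k (f : ℕ → ℕ) → ∑[ i < n ] (f i * k) ≡ ∑< n f * k
∑-distribʳ n k f = begin
  ∑[ i < n ] (f i * k)  ≡⟨ ∑-cong n (λ i _ → *-comm (f i) k) ⟩
  ∑[ i < n ] (k * f i)  ≡⟨ ∑-distribˡ n k f ⟩
  k * ∑< n f            ≡⟨ *-comm k _ ⟩
  ∑< n f * k            ∎
  where open ≡-Reasoning

∑-split : ∀ p q (f : ℕ → ℕ) → ∑< (p + q) f ≡ ∑< p f + ∑[ i < q ] f (p + i)
∑-split zero    q f = refl
∑-split (suc p) q f = trans (cong (f 0 +_) (∑-split p q (f ∘ suc))) (sym (+-assoc (f 0) _ _))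

∑-suc : ∀ n (f : ℕ → ℕ) → ∑< (suc n) f ≡ ∑< n f + f n
∑-suc zero    f = +-comm (f 0) 0
∑-suc (suc n) f = trans (cong (f 0 +_) (∑-suc n (f ∘ suc))) (sym (+-assoc (f 0) _ _))

∑-comm : ∀ n p (f : ℕ → ℕ → ℕ) → ∑[ i < n ] ∑[ j < p ] f i j ≡ ∑[ j < p ] ∑[ i < n ] f i j
∑-comm zero    p f = sym (∑-zero p (λ _ _ → refl))
∑-comm (suc n) p f = trans (cong (∑< p (f 0) +_) (∑-comm n p (f ∘ suc))) (sym (∑-+ p (f 0) _))

∑-truncate : ∀ {r n} (f : ℕ → ℕ) → r ≤ n → (∀ i → r ≤ i → i < n → f i ≡ 0) → ∑< n f ≡ ∑< r f
∑-truncate {r} {n} f r≤n f≡0 = begin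
  ∑< n f                              ≡⟨ cong (λ k → ∑< k f) (m+[n∸m]≡n r≤n) ⟨
  ∑< (r + (n ∸ r)) f                  ≡⟨ ∑-split r (n ∸ r) f ⟩
  ∑< r f + ∑[ i < n ∸ r ] f (r + i)   ≡⟨ cong (∑< r f +_) (∑-zero (n ∸ r) tail≡0) ⟩
  ∑< r f + 0                          ≡⟨ +-identityʳ _ ⟩
  ∑< r f                              ∎
  where
  open ≡-Reasoning
  tail≡0 : ∀ i → i < n ∸ r → f (r + i) ≡ 0
  tail≡0 i i<n∸r = f≡0 (r + i) (m≤m+n r i) (subst (r + i <_) (m+[n∸m]≡n r≤n) (+-monoʳ-< r i<n∸r))

sum-map-applyUpTo : ∀ n (f g : ℕ → ℕ) → sum (map g (applyUpTo f n)) ≡ ∑[ i < n ] g (f i)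
sum-map-applyUpTo zero    f g = refl
sum-map-applyUpTo (suc n) f g = cong (g (f 0) +_) (sum-map-applyUpTo n (f ∘ suc) g)

sum-map-allFin : ∀ n (g : Fin n → ℕ) (f : ℕ → ℕ) → (∀ i → g i ≡ f (toℕ i)) → sum (map g (allFin n)) ≡ ∑< n f
sum-map-allFin n g f g≡f = trans (cong sum (map-tabulate {n = n} (λ i → i) g)) (sum-tabulate n g f g≡f)
  where
  sum-tabulate : ∀ n (g : Fin n → ℕ) (f : ℕ → ℕ) → (∀ i → g i ≡ f (toℕ i)) → sum (tabulate g) ≡ ∑< n f
  sum-tabulate zero    g f g≡f = refl
  sum-tabulate (suc n) g f g≡f =
    cong₂ _+_ (g≡f Fin.zero) (sum-tabulate n (g ∘ Fin.suc) (f ∘ suc) (g≡f ∘ Fin.suc))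

indicator : Bool → ℕ
indicator b = if b then 1 else 0

module _ {A : Set} where

  sum-map-filter : ∀ {p} {P : Pred A p} (P? : Decidable P) (f : A → ℕ) (xs : List A) →
    sum (map f (filter P? xs)) ≡ sum (map (λ x → if does (P? x) then f x else 0) xs)
  sum-map-filter P? f [] = refl
  sum-map-filter P? f (x ∷ xs) with does (P? x)
  ... | true  = cong (f x +_) (sum-map-filter P? f xs)
  ... | false = sum-map-filter P? f xs

  length-filter : ∀ {p} {P : Pred A p} (P? : Decidable P) (xs : List A) →
    length (filter P? xs) ≡ sum (map (indicator ∘ does ∘ P?) xs)
  length-filter P? [] = refl
  length-filter P? (x ∷ xs) with does (P? x)
  ... | true  = cong suc (length-filter P? xs)
  ... | false = length-filter P? xs

  sum-map-concatMap : ∀ {B : Set} (f : B → ℕ) (g : A → List B) (xs : List A) →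
    sum (map f (concatMap g xs)) ≡ sum (map (sum ∘ map f ∘ g) xs)
  sum-map-concatMap f g [] = refl
  sum-map-concatMap f g (x ∷ xs) = begin
    sum (map f (g x ++ concatMap g xs))               ≡⟨ cong sum (map-++ f (g x) _) ⟩
    sum (map f (g x) ++ map f (concatMap g xs))       ≡⟨ sum-++ (map f (g x)) _ ⟩
    sum (map f (g x)) + sum (map f (concatMap g xs))  ≡⟨ cong (sum (map f (g x)) +_) (sum-map-concatMap f g xs) ⟩
    sum (map f (g x)) + sum (map (sum ∘ map f ∘ g) xs)  ∎
    where open ≡-Reasoning

  sum-map-zero : (f : A → ℕ) → (∀ x → f x ≡ 0) → (xs : List A) → sum (map f xs) ≡ 0
  sum-map-zero f f≡0 [] = refl
  sum-map-zero f f≡0 (x ∷ xs) = cong₂ _+_ (f≡0 x) (sum-map-zero f f≡0 xs)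

  sum-map-distribˡ : ∀ k (f : A → ℕ) (xs : List A) → sum (map (λ x → k * f x) xs) ≡ k * sum (map f xs)
  sum-map-distribˡ k f [] = sym (*-zeroʳ k)
  sum-map-distribˡ k f (x ∷ xs) =
    trans (cong (k * f x +_) (sum-map-distribˡ k f xs)) (sym (*-distribˡ-+ k (f x) _))

-- Convolution and the renewal equation

-- The coefficient of x^L in x·U(x)·V(x), for U(x) = Σ u i xⁱ and V(x) = Σ v j xʲ.
infixl 7 _⋆_
_⋆_ : (ℕ → ℕ) → (ℕ → ℕ) → ℕ → ℕ
(u ⋆ v) L = ∑[ j < L ] (u j * v (L ∸ suc j))

⋆-congˡ : ∀ {u u'} v → (∀ x → u x ≡ u' x) → ∀ L → (u ⋆ v) L ≡ (u' ⋆ v) L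
⋆-congˡ v u≡u' L = ∑-cong L (λ j _ → cong (_* v (L ∸ suc j)) (u≡u' j))

⋆-congʳ : ∀ u {v v'} → (∀ x → v x ≡ v' x) → ∀ L → (u ⋆ v) L ≡ (u ⋆ v') L
⋆-congʳ u v≡v' L = ∑-cong L (λ j _ → cong (u j *_) (v≡v' (L ∸ suc j)))

⋆-distribʳ-+ : ∀ u u' v L → ((λ x → u x + u' x) ⋆ v) L ≡ (u ⋆ v) L + (u' ⋆ v) L
⋆-distribʳ-+ u u' v L = trans (∑-cong L (λ j _ → *-distribʳ-+ (v (L ∸ suc j)) (u j) (u' j))) (∑-+ L _ _)

⋆-distribˡ-+ : ∀ u v v' L → (u ⋆ (λ x → v x + v' x)) L ≡ (u ⋆ v) L + (u ⋆ v') L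
⋆-distribˡ-+ u v v' L = trans (∑-cong L (λ j _ → *-distribˡ-+ (u j) (v (L ∸ suc j)) _)) (∑-+ L _ _)

⋆-*ˡ : ∀ k u v L → ((λ x → k * u x) ⋆ v) L ≡ k * (u ⋆ v) L
⋆-*ˡ k u v L = trans (∑-cong L (λ j _ → *-assoc k (u j) (v (L ∸ suc j)))) (∑-distribˡ L k _)

⋆-assoc : ∀ u v w L → ((u ⋆ v) ⋆ w) L ≡ (u ⋆ (v ⋆ w)) L
⋆-assoc u v w zero    = refl
⋆-assoc u v w (suc L) = begin
  ((λ j → u 0 * v j + ((u ∘ suc) ⋆ v) j) ⋆ w) L
    ≡⟨ ⋆-distribʳ-+ (λ j → u 0 * v j) ((u ∘ suc) ⋆ v) w L ⟩
  ((λ j → u 0 * v j) ⋆ w) L + (((u ∘ suc) ⋆ v) ⋆ w) L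
    ≡⟨ cong₂ _+_ (⋆-*ˡ (u 0) v w L) (⋆-assoc (u ∘ suc) v w L) ⟩
  u 0 * (v ⋆ w) L + ((u ∘ suc) ⋆ (v ⋆ w)) L
    ∎
  where open ≡-Reasoning

-- F(x) = E(x) / (1 − k·x·E(x)) for the generating functions.
Renewal : ℕ → (ℕ → ℕ) → (ℕ → ℕ) → Set
Renewal k E F = ∀ x → F x ≡ E x + k * (E ⋆ F) x

-- E/(1 − kxE) = G and F = G/(1 − xG) give F = E/(1 − (k+1)xE).
Renewal-step : ∀ {k E G F} → Renewal k E G → Renewal 1 G F → Renewal (suc k) E F
Renewal-step {k} {E} {G} {F} hG hF x = begin
  F x
    ≡⟨ hF x ⟩
  G x + 1 * (G ⋆ F) x
    ≡⟨ cong₂ _+_ (hG x) (trans (*-identityˡ _) (⋆-congˡ F hG x)) ⟩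
  E x + k * (E ⋆ G) x + ((λ y → E y + k * (E ⋆ G) y) ⋆ F) x
    ≡⟨ cong (E x + k * (E ⋆ G) x +_) (trans (⋆-distribʳ-+ E _ F x)
         (cong ((E ⋆ F) x +_) (trans (⋆-*ˡ k (E ⋆ G) F x) (cong (k *_) (⋆-assoc E G F x))))) ⟩
  E x + k * (E ⋆ G) x + ((E ⋆ F) x + k * (E ⋆ (G ⋆ F)) x)
    ≡⟨ regroup (E x) k ((E ⋆ G) x) ((E ⋆ (G ⋆ F)) x) ((E ⋆ F) x) ⟩
  E x + ((E ⋆ F) x + k * ((E ⋆ G) x + (E ⋆ (G ⋆ F)) x))
    ≡⟨ cong (λ z → E x + ((E ⋆ F) x + k * z)) (⋆-distribˡ-+ E G (G ⋆ F) x) ⟨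
  E x + ((E ⋆ F) x + k * (E ⋆ (λ y → G y + (G ⋆ F) y)) x)
    ≡⟨ cong (λ z → E x + ((E ⋆ F) x + k * z)) (⋆-congʳ E (λ y → trans (cong (G y +_) (sym (*-identityˡ _))) (sym (hF y))) x) ⟩
  E x + suc k * (E ⋆ F) x
    ∎
  where
  open ≡-Reasoning
  regroup : ∀ e k a b p → e + k * a + (p + k * b) ≡ e + (p + k * (a + b))
  regroup = solve-∀

Renewal-unique : ∀ {k E F G} → Renewal k E F → Renewal k E G → ∀ x → F x ≡ G x
Renewal-unique {k} {E} {F} {G} hF hG = <-rec (λ x → F x ≡ G x) agree
  where
  agree : ∀ x → (∀ {y} → y < x → F y ≡ G y) → F x ≡ G x
  agree x F≡G = begin
    F x                      ≡⟨ hF x ⟩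
    E x + k * (E ⋆ F) x      ≡⟨ cong (λ z → E x + k * z) (∑-cong x (λ j j<x → cong (E j *_) (F≡G (∸-monoʳ-< z<s j<x)))) ⟩
    E x + k * (E ⋆ G) x      ≡⟨ hG x ⟨
    G x                      ∎
    where open ≡-Reasoning

-- The invert transform

module _ (f : ℕ → ℕ) where

  -- convPower k r = Σ_{i₁+⋯+iₖ=r, iⱼ ≥ 1} f i₁ ⋯ f iₖ, computed by peeling off i₁ = suc t.
  convPower : ℕ → ℕ → ℕ
  convPower zero    zero    = 1
  convPower zero    (suc r) = 0
  convPower (suc k) r       = ∑[ t < r ] (f (suc t) * convPower k (r ∸ suc t))

  weight : ℕ → List ℕ → ℕ
  weight r t = if does (sum t ≟ r) then product (map f t) else 0

  weight-∷ : ∀ {i r} t → i ≤ r → weight r (i ∷ t) ≡ f i * weight (r ∸ i) t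
  -- `does (m ≟ n)` computes to `m ≡ᵇ n`, so `with` cannot abstract over the decisions; we
  -- pass them as arguments instead.
  weight-∷ {i} {r} t i≤r = by-cases (i + sum t ≟ r) (sum t ≟ r ∸ i)
    where
    by-cases : (d : Dec (i + sum t ≡ r)) (e : Dec (sum t ≡ r ∸ i)) →
      (if does d then f i * product (map f t) else 0) ≡ f i * (if does e then product (map f t) else 0)
    by-cases (yes _)  (yes _)  = refl
    by-cases (no _)   (no _)   = sym (*-zeroʳ (f i))
    by-cases (yes eq) (no neq) = ⊥-elim (neq (trans (sym (m+n∸m≡n i (sum t))) (cong (_∸ i) eq)))
    by-cases (no neq) (yes eq) = ⊥-elim (neq (trans (cong (i +_) eq) (m+[n∸m]≡n i≤r)))

  weight-∷-> : ∀ {i r} t → r < i → weight r (i ∷ t) ≡ 0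
  weight-∷-> {i} {r} t r<i = by-cases (i + sum t ≟ r)
    where
    by-cases : (d : Dec (i + sum t ≡ r)) → (if does d then f i * product (map f t) else 0) ≡ 0
    by-cases (yes eq) = ⊥-elim (<⇒≱ r<i (subst (i ≤_) eq (m≤m+n i (sum t))))
    by-cases (no _)   = refl

  sum-weight-tuples : ∀ k {n r} → r ≤ n → sum (map (weight r) (tuples k n)) ≡ convPower k r
  sum-weight-tuples zero {r = zero}  _ = refl
  sum-weight-tuples zero {r = suc r} _ = refl
  sum-weight-tuples (suc k) {n} {r} r≤n = begin
    sum (map (weight r) (concatMap (λ i → map (i ∷_) (tuples k n)) (map suc (upTo n))))
      ≡⟨ sum-map-concatMap (weight r) (λ i → map (i ∷_) (tuples k n)) (map suc (upTo n)) ⟩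
    sum (map (λ i → sum (map (weight r) (map (i ∷_) (tuples k n)))) (map suc (upTo n)))
      ≡⟨ cong sum (map-∘ (upTo n)) ⟨
    sum (map (λ j → sum (map (weight r) (map (suc j ∷_) (tuples k n)))) (upTo n))
      ≡⟨ sum-map-applyUpTo n (λ j → j) _ ⟩
    ∑[ j < n ] sum (map (weight r) (map (suc j ∷_) (tuples k n)))
      ≡⟨ ∑-cong n (λ j _ → cong sum (map-∘ (tuples k n))) ⟨
    ∑[ j < n ] sum (map (λ t → weight r (suc j ∷ t)) (tuples k n))
      ≡⟨ ∑-truncate _ r≤n (λ j r≤j _ → sum-map-zero _ (λ t → weight-∷-> t (s≤s r≤j)) (tuples k n)) ⟩
    ∑[ j < r ] sum (map (λ t → weight r (suc j ∷ t)) (tuples k n))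
      ≡⟨ ∑-cong r (λ j j<r → first-part j j<r) ⟩
    convPower (suc k) r
      ∎
    where
    open ≡-Reasoning
    first-part : ∀ j → j < r → sum (map (λ t → weight r (suc j ∷ t)) (tuples k n))
                                 ≡ f (suc j) * convPower k (r ∸ suc j)
    first-part j j<r = begin
      sum (map (λ t → weight r (suc j ∷ t)) (tuples k n))
        ≡⟨ cong sum (map-cong (λ t → weight-∷ t j<r) (tuples k n)) ⟩
      sum (map (λ t → f (suc j) * weight (r ∸ suc j) t) (tuples k n))
        ≡⟨ sum-map-distribˡ (f (suc j)) _ (tuples k n) ⟩
      f (suc j) * sum (map (weight (r ∸ suc j)) (tuples k n))
        ≡⟨ cong (f (suc j) *_) (sum-weight-tuples k (≤-trans (m∸n≤m r (suc j)) r≤n)) ⟩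
      f (suc j) * convPower k (r ∸ suc j)
        ∎

  c≡convPower : ∀ n k → c f n k ≡ convPower k n
  c≡convPower n k =
    trans (sum-map-filter (λ t → sum t ≟ n) (product ∘ map f) (tuples k n)) (sum-weight-tuples k ≤-refl)

  convPower-< : ∀ {k r} → r < k → convPower k r ≡ 0
  convPower-< {suc k} {r} r≤k = ∑-zero r (λ t t<r →
    trans (cong (f (suc t) *_) (convPower-< (<-≤-trans (∸-monoʳ-< z<s t<r) (s≤s⁻¹ r≤k))))
          (*-zeroʳ (f (suc t))))

  convPower-one : ∀ r → convPower 1 (suc r) ≡ f (suc r)
  convPower-one r = begin
    ∑[ t < suc r ] (f (suc t) * convPower 0 (suc r ∸ suc t))
      ≡⟨ ∑-suc r _ ⟩
    ∑[ t < r ] (f (suc t) * convPower 0 (r ∸ t)) + f (suc r) * convPower 0 (r ∸ r)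
      ≡⟨ cong₂ _+_ (∑-zero r (λ t t<r → trans (cong (λ z → f (suc t) * convPower 0 z) (+-∸-assoc 1 t<r))
                                              (*-zeroʳ (f (suc t)))))
                   (cong (λ z → f (suc r) * convPower 0 z) (n∸n≡0 r)) ⟩
    f (suc r) * 1
      ≡⟨ *-identityʳ _ ⟩
    f (suc r)
      ∎
    where open ≡-Reasoning

  invert≡∑convPower : ∀ n → invert f n ≡ ∑[ t < n ] convPower (suc t) n
  invert≡∑convPower n = begin
    sum (map (c f n) (map suc (upTo n)))    ≡⟨ cong sum (map-∘ (upTo n)) ⟨
    sum (map (c f n ∘ suc) (upTo n))        ≡⟨ sum-map-applyUpTo n (λ t → t) (c f n ∘ suc) ⟩
    ∑[ t < n ] c f n (suc t)                ≡⟨ ∑-cong n (λ t _ → c≡convPower n (suc t)) ⟩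
    ∑[ t < n ] convPower (suc t) n          ∎
    where open ≡-Reasoning

  ∑convPower≡invert : ∀ {r n} → r ≤ n → ∑[ t < n ] convPower (suc t) r ≡ invert f r
  ∑convPower≡invert {r} r≤n =
    trans (∑-truncate _ r≤n (λ t r≤t _ → convPower-< (s≤s r≤t))) (sym (invert≡∑convPower r))

  invert-renewal : Renewal 1 (f ∘ suc) (invert f ∘ suc)
  invert-renewal L = begin
    invert f (suc L)
      ≡⟨ invert≡∑convPower (suc L) ⟩
    convPower 1 (suc L) + ∑[ t < L ] ∑[ s < suc L ] (f (suc s) * convPower (suc t) (L ∸ s))
      ≡⟨ cong₂ _+_ (convPower-one L) (∑-comm L (suc L) (λ t s → f (suc s) * convPower (suc t) (L ∸ s))) ⟩
    f (suc L) + ∑[ s < suc L ] ∑[ t < L ] (f (suc s) * convPower (suc t) (L ∸ s))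
      ≡⟨ cong (f (suc L) +_) (∑-cong (suc L) λ s _ →
           trans (∑-distribˡ L (f (suc s)) _)
                 (cong (f (suc s) *_) (∑convPower≡invert (m∸n≤m L s)))) ⟩
    f (suc L) + ∑[ s < suc L ] (f (suc s) * invert f (L ∸ s))
      ≡⟨ cong (f (suc L) +_) (∑-suc L _) ⟩
    f (suc L) + (tail + f (suc L) * invert f (L ∸ L))
      ≡⟨ cong (λ z → f (suc L) + (tail + f (suc L) * invert f z)) (n∸n≡0 L) ⟩
    f (suc L) + (tail + f (suc L) * 0)
      ≡⟨ cong (f (suc L) +_) (trans (cong (tail +_) (*-zeroʳ (f (suc L)))) (+-identityʳ tail)) ⟩
    f (suc L) + tail
      ≡⟨ cong (f (suc L) +_) (∑-cong L (λ s s<L → cong (λ z → f (suc s) * invert f z) (+-∸-assoc 1 s<L))) ⟩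
    f (suc L) + ((f ∘ suc) ⋆ (invert f ∘ suc)) L
      ≡⟨ cong (f (suc L) +_) (*-identityˡ _) ⟨
    f (suc L) + 1 * ((f ∘ suc) ⋆ (invert f ∘ suc)) L
      ∎
    where
    open ≡-Reasoning
    tail : ℕ
    tail = ∑[ s < L ] (f (suc s) * invert f (L ∸ s))

iterInvert-renewal : ∀ a m → Renewal m (a C_) (λ x → iterInvert m (f₀ a) (suc x))
iterInvert-renewal a zero    x = sym (+-identityʳ _)
iterInvert-renewal a (suc m) =
  Renewal-step {m} {a C_} (iterInvert-renewal a m) (invert-renewal (iterInvert m (f₀ a)))

-- Counting words with property P₁

∑-C-hockey : ∀ d k → ∑[ i < d ] ((d ∸ suc i) C k) ≡ d C suc k
∑-C-hockey zero    k = refl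
∑-C-hockey (suc d) k = trans (cong (d C k +_) (∑-C-hockey d k)) (nCk+nC[k+1]≡[n+1]C[k+1] d k)

∑-C-hockey-⋆ : ∀ d v L → ∑[ i < d ] (((d ∸ suc i) C_) ⋆ v) L ≡ ((λ j → d C suc j) ⋆ v) L
∑-C-hockey-⋆ d v L = begin
  ∑[ i < d ] ∑[ j < L ] (((d ∸ suc i) C j) * v (L ∸ suc j))
    ≡⟨ ∑-comm d L (λ i j → ((d ∸ suc i) C j) * v (L ∸ suc j)) ⟩
  ∑[ j < L ] ∑[ i < d ] (((d ∸ suc i) C j) * v (L ∸ suc j))
    ≡⟨ ∑-cong L (λ j _ → trans (∑-distribʳ d (v (L ∸ suc j)) (λ i → (d ∸ suc i) C j))
                               (cong (_* v (L ∸ suc j)) (∑-C-hockey d j))) ⟩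
  ∑[ j < L ] ((d C suc j) * v (L ∸ suc j))
    ∎
  where open ≡-Reasoning

StartsAtLeast : ℕ → List ℕ → Set
StartsAtLeast b []      = ⊤
StartsAtLeast b (y ∷ _) = b ≤ y

startsAtLeast-zero : ∀ B → StartsAtLeast 0 B
startsAtLeast-zero []      = tt
startsAtLeast-zero (_ ∷ _) = z≤n

Linked-∷⇔ : ∀ {y B} → Linked _<_ (y ∷ B) ⇔ (StartsAtLeast (suc y) B × Linked _<_ B)
Linked-∷⇔ {B = []}    = mk⇔ (λ _ → tt , []) (λ _ → [-])
Linked-∷⇔ {B = _ ∷ _} = mk⇔ (λ { (y<z ∷ l) → y<z , l }) (λ (y<z , l) → y<z ∷ l)

firstBlock : List (List ℕ) → List ℕ
firstBlock []      = []
firstBlock (B ∷ _) = B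

AscendingFrom : ℕ → List (List ℕ) → Set
AscendingFrom b bs = All (Linked _<_) bs × StartsAtLeast b (firstBlock bs)

joinFirst : ℕ → List (List ℕ) → List (List ℕ)
joinFirst y []       = (y ∷ []) ∷ []
joinFirst y (B ∷ bs) = (y ∷ B) ∷ bs

AscendingFrom-zero : ∀ {bs} → AscendingFrom 0 bs ⇔ All (Linked _<_) bs
AscendingFrom-zero {bs} = mk⇔ proj₁ (λ all → all , startsAtLeast-zero (firstBlock bs))

AscendingFrom-[]∷ : ∀ {b bs} → AscendingFrom b ([] ∷ bs) ⇔ AscendingFrom 0 bs
AscendingFrom-[]∷ {bs = bs} =
  mk⇔ (λ { ([] ∷ all , _) → all , startsAtLeast-zero (firstBlock bs) }) (λ (all , _) → [] ∷ all , tt)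

AscendingFrom-joinFirst : ∀ {b y} bs → b ≤ y → AscendingFrom b (joinFirst y bs) ⇔ AscendingFrom (suc y) bs
AscendingFrom-joinFirst []       b≤y = mk⇔ (λ _ → [] , tt) (λ _ → [-] ∷ [] , b≤y)
AscendingFrom-joinFirst (B ∷ bs) b≤y = mk⇔
  (λ { (lyB ∷ all , _) → let (s , lB) = Equivalence.to Linked-∷⇔ lyB in lB ∷ all , s })
  (λ { (lB ∷ all , s) → Equivalence.from Linked-∷⇔ (s , lB) ∷ all , b≤y })

AscendingFrom-joinFirst-< : ∀ {b y} bs → y < b → ¬ AscendingFrom b (joinFirst y bs)
AscendingFrom-joinFirst-< []      y<b (_ , b≤y) = <⇒≱ y<b b≤y
AscendingFrom-joinFirst-< (_ ∷ _) y<b (_ , b≤y) = <⇒≱ y<b b≤y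

module _ (a : ℕ) where

  -- The effect of reading the letter i when the current small block may only continue with
  -- letters ≥ b: a small letter ≥ b continues it, a smaller one is rejected, a large one restarts.
  caseLetter : {A : Set} → ℕ → ℕ → A → A → A → A
  caseLetter b i reject continue restart with i <? a
  ... | no _ = restart
  ... | yes _ with b ≤? i
  ...   | yes _ = continue
  ...   | no _  = reject

  caseLetter-reject : ∀ {A : Set} {b i} {r x y : A} → i < b → i < a → caseLetter b i r x y ≡ r
  caseLetter-reject {b = b} {i} i<b i<a with i <? a
  ... | no i≮a = ⊥-elim (i≮a i<a)
  ... | yes _ with b ≤? i
  ...   | yes b≤i = ⊥-elim (<⇒≱ i<b b≤i)
  ...   | no _    = refl

  caseLetter-continue : ∀ {A : Set} {b i} {r x y : A} → b ≤ i → i < a → caseLetter b i r x y ≡ x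
  caseLetter-continue {b = b} {i} b≤i i<a with i <? a
  ... | no i≮a = ⊥-elim (i≮a i<a)
  ... | yes _ with b ≤? i
  ...   | yes _   = refl
  ...   | no b≰i  = ⊥-elim (b≰i b≤i)

  caseLetter-restart : ∀ {A : Set} {b i} {r x y : A} → a ≤ i → caseLetter b i r x y ≡ y
  caseLetter-restart {i = i} a≤i with i <? a
  ... | no _    = refl
  ... | yes i<a = ⊥-elim (<⇒≱ i<a a≤i)

  sum-indicator-caseLetter : ∀ {X : Set} b i (p q : X → Bool) (xs : List X) →
    sum (map (λ x → indicator (caseLetter b i false (p x) (q x))) xs)
      ≡ caseLetter b i 0 (sum (map (indicator ∘ p) xs)) (sum (map (indicator ∘ q) xs))
  sum-indicator-caseLetter b i p q xs with i <? a
  ... | no _ = refl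
  ... | yes _ with b ≤? i
  ...   | yes _ = refl
  ...   | no _  = sum-map-zero _ (λ _ → refl) xs

  admissible : ∀ {N} → ℕ → List (Fin N) → Bool
  admissible b []      = true
  admissible b (x ∷ w) = caseLetter b (toℕ x) false (admissible (suc (toℕ x)) w) (admissible 0 w)

  smallBlocks-small : ∀ {N} (x : Fin N) w → toℕ x < a → smallBlocks a (x ∷ w) ≡ joinFirst (toℕ x) (smallBlocks a w)
  smallBlocks-small x w x<a with toℕ x <? a | smallBlocks a w
  ... | yes _  | []    = refl
  ... | yes _  | _ ∷ _ = refl
  ... | no x≮a | _     = ⊥-elim (x≮a x<a)

  smallBlocks-large : ∀ {N} (x : Fin N) w → a ≤ toℕ x → smallBlocks a (x ∷ w) ≡ [] ∷ smallBlocks a w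
  smallBlocks-large x w a≤x with toℕ x <? a | smallBlocks a w
  ... | yes x<a | _ = ⊥-elim (<⇒≱ x<a a≤x)
  ... | no _    | _ = refl

  admissible⇔ : ∀ {N} b (w : List (Fin N)) → T (admissible b w) ⇔ AscendingFrom b (smallBlocks a w)
  admissible⇔ b [] = mk⇔ (λ _ → [] ∷ [] , tt) (λ _ → tt)
  admissible⇔ b (x ∷ w) with ≤-<-connex a (toℕ x)
  ... | inj₁ a≤x rewrite smallBlocks-large x w a≤x | caseLetter-restart {b = b} {r = false}
                           {admissible (suc (toℕ x)) w} {admissible 0 w} a≤x =
    ⇔-trans (admissible⇔ 0 w) (⇔-sym (AscendingFrom-[]∷ {b}))
  ... | inj₂ x<a rewrite smallBlocks-small x w x<a with ≤-<-connex b (toℕ x)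
  ...   | inj₁ b≤x rewrite caseLetter-continue {r = false}
                             {admissible (suc (toℕ x)) w} {admissible 0 w} b≤x x<a =
    ⇔-trans (admissible⇔ (suc (toℕ x)) w) (⇔-sym (AscendingFrom-joinFirst (smallBlocks a w) b≤x))
  ...   | inj₂ x<b rewrite caseLetter-reject {r = false}
                             {admissible (suc (toℕ x)) w} {admissible 0 w} x<b x<a =
    mk⇔ (λ ()) (AscendingFrom-joinFirst-< (smallBlocks a w) x<b)

  does-P₁? : ∀ {N} (w : List (Fin N)) → does (P₁? a w) ≡ admissible 0 w
  does-P₁? w = does-⇔ (⇔-trans (⇔-sym AscendingFrom-zero) (⇔-sym (admissible⇔ 0 w))) (P₁? a w) (T? _)

module _ (a m : ℕ) where

  count : ℕ → ℕ → ℕ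
  count b L = sum (map (indicator ∘ admissible a b) (words (a + m) L))

  countP₁≡count : ∀ L → countP₁ a m L ≡ count 0 L
  countP₁≡count L = trans (length-filter (P₁? a) (words (a + m) L))
                          (cong sum (map-cong (cong indicator ∘ does-P₁? a) (words (a + m) L)))

  count-suc : ∀ b L → count b (suc L) ≡ ∑[ i < a + m ] caseLetter a b i 0 (count (suc i) L) (count 0 L)
  count-suc b L = begin
    sum (map (indicator ∘ admissible a b) (concatMap (λ x → map (x ∷_) ws) (allFin (a + m))))
      ≡⟨ sum-map-concatMap (indicator ∘ admissible a b) (λ x → map (x ∷_) ws) (allFin (a + m)) ⟩
    sum (map (λ x → sum (map (indicator ∘ admissible a b) (map (x ∷_) ws))) (allFin (a + m)))
      ≡⟨ sum-map-allFin (a + m) _ _ (λ x → trans (cong sum (sym (map-∘ ws)))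
           (sum-indicator-caseLetter a b (toℕ x) (admissible a (suc (toℕ x))) (admissible a 0) ws)) ⟩
    ∑[ i < a + m ] caseLetter a b i 0 (count (suc i) L) (count 0 L)
      ∎
    where
    open ≡-Reasoning
    ws : List (List (Fin (a + m)))
    ws = words (a + m) L

  count-split : ∀ {b d} L → b + d ≡ a → count b (suc L) ≡ ∑[ i < d ] count (suc (b + i)) L + m * count 0 L
  count-split {b} {d} L b+d≡a = begin
    count b (suc L)
      ≡⟨ count-suc b L ⟩
    ∑< (a + m) next
      ≡⟨ cong (λ n → ∑< n next) (trans (cong (_+ m) (sym b+d≡a)) (+-assoc b d m)) ⟩
    ∑< (b + (d + m)) next
      ≡⟨ trans (∑-split b (d + m) next) (cong (∑< b next +_) (∑-split d m (next ∘ (b +_)))) ⟩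
    ∑< b next + (∑[ i < d ] next (b + i) + ∑[ i < m ] next (b + (d + i)))
      ≡⟨ cong₂ _+_ (∑-zero b (λ i i<b → caseLetter-reject a i<b (<-≤-trans i<b b≤a)))
                   (cong₂ _+_ (∑-cong d (λ i i<d → caseLetter-continue a (m≤m+n b i) (b+i<a i<d)))
                              (trans (∑-cong m (λ i _ → caseLetter-restart a (a≤b+[d+i] i))) (∑-const m (count 0 L)))) ⟩
    ∑[ i < d ] count (suc (b + i)) L + m * count 0 L
      ∎
    where
    open ≡-Reasoning
    next : ℕ → ℕ
    next i = caseLetter a b i 0 (count (suc i) L) (count 0 L)
    b≤a : b ≤ a
    b≤a = subst (b ≤_) b+d≡a (m≤m+n b d)
    b+i<a : ∀ {i} → i < d → b + i < a
    b+i<a i<d = subst (_ <_) b+d≡a (+-monoʳ-< b i<d)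
    a≤b+[d+i] : ∀ i → a ≤ b + (d + i)
    a≤b+[d+i] i = subst (_≤ b + (d + i)) b+d≡a (+-monoʳ-≤ b (m≤m+n d i))

  count-closed : ∀ L {b d} → b + d ≡ a → count b L ≡ d C L + m * ((d C_) ⋆ count 0) L
  count-closed zero    _ = cong suc (sym (*-zeroʳ m))
  count-closed (suc L) {b} {d} b+d≡a = begin
    count b (suc L)
      ≡⟨ count-split L b+d≡a ⟩
    ∑[ i < d ] count (suc (b + i)) L + m * g L
      ≡⟨ cong (_+ m * g L) (∑-cong d (λ i i<d → count-closed L (shift i<d))) ⟩
    ∑[ i < d ] ((d ∸ suc i) C L + m * (((d ∸ suc i) C_) ⋆ g) L) + m * g L
      ≡⟨ cong (_+ m * g L) (trans (∑-+ d _ _) (cong₂ _+_ (∑-C-hockey d L)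
           (trans (∑-distribˡ d m _) (cong (m *_) (∑-C-hockey-⋆ d g L))))) ⟩
    d C suc L + m * ((λ j → d C suc j) ⋆ g) L + m * g L
      ≡⟨ regroup (d C suc L) m (((λ j → d C suc j) ⋆ g) L) (g L) ⟩
    d C suc L + m * (1 * g L + ((λ j → d C suc j) ⋆ g) L)
      ≡⟨⟩
    d C suc L + m * ((d C_) ⋆ g) (suc L)
      ∎
    where
    open ≡-Reasoning
    g : ℕ → ℕ
    g = count 0
    regroup : ∀ c m x y → c + m * x + m * y ≡ c + m * (1 * y + x)
    regroup = solve-∀
    shift : ∀ {i} → i < d → suc (b + i) + (d ∸ suc i) ≡ a
    shift {i} i<d = begin
      suc (b + i) + (d ∸ suc i)  ≡⟨ cong (_+ (d ∸ suc i)) (+-suc b i) ⟨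
      b + suc i + (d ∸ suc i)    ≡⟨ +-assoc b (suc i) _ ⟩
      b + (suc i + (d ∸ suc i))  ≡⟨ cong (b +_) (m+[n∸m]≡n i<d) ⟩
      b + d                      ≡⟨ b+d≡a ⟩
      a                          ∎

  count-renewal : Renewal m (a C_) (count 0)
  count-renewal L = count-closed L refl

mainTheorem2 : (a m : ℕ) → 1 ≤ a → 1 ≤ m → (n : ℕ) → 1 ≤ n →
    iterInvert m (f₀ a) n ≡ countP₁ a m (n ∸ 1)
mainTheorem2 a m _ _ (suc L) _ = begin
  iterInvert m (f₀ a) (suc L)  ≡⟨ Renewal-unique {m} {a C_} (iterInvert-renewal a m) (count-renewal a m) L ⟩
  count a m 0 L                ≡⟨ countP₁≡count a m L ⟨
  countP₁ a m L                ∎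
  where open ≡-Reasoning
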